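{- Let $\mu^-,\mu^+$ be dyadic rationals with $0\le\mu^-,\mu^+\le1$ and $\mu=\frac{\mu^-+\mu^+}{2}=\frac14+r$, where $0<r\le\frac14$. Suppose that $\mu^-\le r$. Then $I[\mathcal{L}_{\mu^-,\mu^+}]\ge I[\mathcal{L}_\mu]+2\mu^-$.
   Context: For $\mathcal{H}\subset\mathcal{P}([N])$, $\mathrm{Inf}_i[\mathcal{H}]$ is the probability, for $A$ uniform in $\mathcal{P}([N])$, that exactly one of $A$, $A\Delta\{i\}$ lies in $\mathcal{H}$, and $I[\mathcal{H}]=\sum_i\mathrm{Inf}_i[\mathcal{H}]$. The lexicographic order on $\mathcal{P}(X)$ is $S>T$ iff $\min(S\Delta T)\in S$. For a dyadic rational $\mu\in[0,1]$, $I[\mathcal{L}_\mu]$ is the total influence of the initial segment (largest sets) of the lexicographic order on $\mathcal{P}([m])$ of measure $\mu$, for any $m$ with $2^m\mu\in\mathbb{Z}$ (independent of $m$). For dyadic $\mu^-,\mu^+\in[0,1]$, $\mathcal{L}_{\mu^-,\mu^+}$ represents the family in $\mathcal{P}([m+1])$ (any $m$ with $2^m\mu^\pm\in\mathbb{Z}$) whose slice $\{S\setminus\{1\}:1\in S\}$ is the lexicographic initial segment of $\mathcal{P}(\{2,\dots,m+1\})$ of measure $\mu^+$ and whose slice $\{S:1\notin S\}$ is the lexicographic initial segment of measure $\mu^-$; $I[\mathcal{L}_{\mu^-,\mu^+}]$ is its total influence (independent of $m$). -}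

module Defs where

open import Data.Bool using (Bool; true; false; not; _xor_; if_then_else_)
open import Data.Nat using (ℕ; zero; suc; _^_; _≤ᵇ_) renaming (_+_ to _+ℕ_)
open import Data.Nat.Properties using (m^n≢0)
open import Data.Fin using (Fin)
open import Data.Vec using (Vec; []; _∷_; _[_]%=_)
open import Data.List using (List; []; _∷_; map; _++_; foldr; allFin)
open import Data.Nat.ListAction using (sum)
open import Data.Integer using (+_)
open import Data.Rational using (ℚ; _/_; 0ℚ; _+_)

-- A subset S of [N] = {1,…,N} is its characteristic vector:
-- position 0 of the vector corresponds to element 1, …, position N-1 to element N.
Subset : ℕ → Set
Subset N = Vec Bool N

Family : ℕ → Set
Family N = Subset N → Bool

allSubsets : (N : ℕ) → List (Subset N)
allSubsets zero    = [] ∷ []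
allSubsets (suc N) = map (true ∷_) (allSubsets N) ++ map (false ∷_) (allSubsets N)

toggle : {N : ℕ} → Fin N → Subset N → Subset N
toggle i A = A [ i ]%= not

count : {A : Set} → (A → Bool) → List A → ℕ
count p xs = sum (map (λ x → if p x then 1 else 0) xs)

infCount : {N : ℕ} → Family N → Fin N → ℕ
infCount {N} H i = count (λ A → H A xor H (toggle i A)) (allSubsets N)

dyadic : ℕ → ℕ → ℚ
dyadic k m = (+ k) / (2 ^ m) where instance _ = m^n≢0 2 m

Inf : {N : ℕ} → Family N → Fin N → ℚ
Inf {N} H i = dyadic (infCount H i) N

totalInfluence : {N : ℕ} → Family N → ℚ
totalInfluence {N} H = foldr _+_ 0ℚ (map (Inf H) (allFin N))

-- Lexicographic order: S > T iff min(S Δ T) ∈ S. With element 1 as the most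
-- significant bit, this is the order of the binary number below.
binVal : {N : ℕ} → Subset N → ℕ
binVal {zero}  []       = 0
binVal {suc N} (b ∷ bs) = (if b then 2 ^ N else 0) +ℕ binVal bs

-- Initial segment (largest sets) of the lexicographic order on P([N]) with
-- exactly k sets (measure k / 2^N), for k ≤ 2^N: the sets S with
-- binVal S ≥ 2^N - k, i.e. 2^N ≤ binVal S +ℕ k.
lexSeg : (N k : ℕ) → Family N
lexSeg N k S = 2 ^ N ≤ᵇ binVal S +ℕ k

-- L_{μ⁻,μ⁺} in P([m+1]) with μ⁻ = a/2^m, μ⁺ = b/2^m:
-- slice {S∖{1} : 1 ∈ S} is lexSeg m b, slice {S : 1 ∉ S} is lexSeg m a.
lexTwo : (m a b : ℕ) → Family (suc m)
lexTwo m a b (true  ∷ S) = lexSeg m b S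
lexTwo m a b (false ∷ S) = lexSeg m a S

-- Multiplied by 2^(m+1), everything is a count of natural numbers; write
-- L_N(k) for 2^N times the total influence of the lexicographic segment of size k
-- in P([N]).  Splitting a family along coordinate 1 gives
--   2^(N+1) I[H] = 2 |H₁ Δ H₀| + 2^N I[H₁] + 2^N I[H₀],
-- so L_{N+1}(k) = 2k + L_N(k) for k ≤ 2^N, and for slices of sizes a ≤ b with
-- a + b ≤ 2^m (that is, r ≤ 1/4) the claim becomes 8a + L_m(a+b) ≤ L_m(a) + L_m(b).
-- The core is subadditivity with a bonus, 4 min(y,z) + L_N(y+z) ≤ L_N(y) + L_N(z)
-- for y + z ≤ 2^N, by induction on N with the symmetry L_N(k) = L_N(2^N - k).
-- The hypothesis μ⁻ ≤ r says b ≥ a + 2^(m-1), and one splitting step turns the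
-- bonus 4a for the pair (a, b - 2^(m-1)) into the bonus 8a.
module Submission where

open import Defs
open import Data.Bool using (Bool; true; false; T; if_then_else_; _xor_)
open import Data.Bool.Properties using (xor-comm; xor-same)
open import Data.Empty using (⊥-elim)
open import Data.Fin using (Fin) renaming (zero to fzero; suc to fsuc)
open import Data.Integer as ℤ using (+≤+)
import Data.Integer.Properties as ℤₚ
open import Data.List using ([]; _∷_; map; _++_; foldr; allFin)
open import Data.List.Properties using (map-++; map-∘; map-cong; map-tabulate)
import Data.Nat as ℕ
open import Data.Nat using (ℕ; zero; suc; pred; _+_; _*_; _^_; _≤_; _≤ᵇ_; _≤?_; s≤s; z≤n)
open import Data.Nat.ListAction using (sum)
open import Data.Nat.ListAction.Properties using (sum-++)
open import Data.Nat.Properties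
  using ( +-identityʳ; +-assoc; +-comm; *-identityʳ; *-distribˡ-+; *-distribʳ-+; ^-distribˡ-+-*; suc-pred; m^n≢0
        ; +-cancelˡ-≡; +-cancelʳ-≡; +-cancelˡ-≤; +-cancelʳ-≤; *-cancelˡ-≤; *-cancelʳ-≤
        ; +-monoˡ-≤; +-monoʳ-≤; +-mono-≤; +-monoʳ-<; +-mono-<-≤; *-monoˡ-≤; *-monoʳ-≤
        ; ≤-refl; ≤-reflexive; ≤-trans; ≤-total; <⇒≤; <⇒≱; ≰⇒>; ≰⇒≥; n≮0; m≤m+n; m≤n+m; m≤n⇒∃[o]m+o≡n
        ; ≤ᵇ⇒≤; ≤⇒≤ᵇ; ≤ᵇ-reflects-≤; +-commutativeSemigroup; module ≤-Reasoning)
open import Algebra.Properties.CommutativeSemigroup +-commutativeSemigroup using (x∙yz≈y∙xz)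
open import Data.Nat.Tactic.RingSolver using (solve-∀)
open import Data.Product using (_,_)
open import Data.Rational using (ℚ; 0ℚ; _<_; toℚᵘ; fromℚᵘ) renaming (_+_ to _+ℚ_; _*_ to _*ℚ_; _≤_ to _≤ℚ_)
import Data.Rational.Properties as ℚₚ
open import Data.Rational.Unnormalised as ℚᵘ using (ℚᵘ; mkℚᵘ; ↥_; ↧_; *≡*; *≤*)
import Data.Rational.Unnormalised.Properties as ℚᵘₚ
open import Data.Sum using (inj₁; inj₂)
import Data.Vec as Vec
open import Data.Vec using (_∷_)
open import Function using (_∘_)
open import Relation.Binary.PropositionalEquality
  using (_≡_; refl; sym; trans; cong; cong₂; subst₂; _≗_; module ≡-Reasoning)
open import Relation.Nullary using (yes; no)
open import Relation.Nullary.Reflects using (det; fromEquivalence; ofʸ; ofⁿ)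

indicator : Bool → ℕ
indicator b = if b then 1 else 0

sum-map-+ : ∀ {A : Set} (f g : A → ℕ) xs → sum (map (λ x → f x + g x) xs) ≡ sum (map f xs) + sum (map g xs)
sum-map-+ f g [] = refl
sum-map-+ f g (x ∷ xs) = trans (cong ((f x + g x) +_) (sum-map-+ f g xs)) (shuffle (f x) (g x) _ _)
  where
  shuffle : ∀ a b c d → (a + b) + (c + d) ≡ (a + c) + (b + d)
  shuffle = solve-∀

sum-map-zero : ∀ {A : Set} {f : A → ℕ} → (∀ x → f x ≡ 0) → ∀ xs → sum (map f xs) ≡ 0
sum-map-zero f≡0 [] = refl
sum-map-zero f≡0 (x ∷ xs) = cong₂ _+_ (f≡0 x) (sum-map-zero f≡0 xs)

sum-map-allFin-suc : ∀ N (f : Fin (suc N) → ℕ) → sum (map f (allFin (suc N))) ≡ f fzero + sum (map (f ∘ fsuc) (allFin N))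
sum-map-allFin-suc N f = cong (λ xs → f fzero + sum xs) (trans (map-tabulate fsuc f) (sym (map-tabulate (λ i → i) (f ∘ fsuc))))

count-++ : ∀ {A : Set} (p : A → Bool) xs ys → count p (xs ++ ys) ≡ count p xs + count p ys
count-++ p xs ys = trans (cong sum (map-++ _ xs ys)) (sum-++ (map _ xs) (map _ ys))

count-map : ∀ {A B : Set} (p : B → Bool) (f : A → B) xs → count p (map f xs) ≡ count (p ∘ f) xs
count-map p f xs = cong sum (sym (map-∘ xs))

count-cong : ∀ {A : Set} {p q : A → Bool} → p ≗ q → ∀ xs → count p xs ≡ count q xs
count-cong p≗q xs = cong sum (map-cong (cong indicator ∘ p≗q) xs)

count-false : ∀ {A : Set} {p : A → Bool} → (∀ x → p x ≡ false) → ∀ xs → count p xs ≡ 0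
count-false p≡false = sum-map-zero (cong indicator ∘ p≡false)

count-xor-⊆ : ∀ {A : Set} (p q : A → Bool) → (∀ x → T (q x) → T (p x)) → ∀ xs →
              count (λ x → p x xor q x) xs + count q xs ≡ count p xs
count-xor-⊆ p q q⊆p [] = refl
count-xor-⊆ p q q⊆p (x ∷ xs) = trans (shuffle (indicator (p x xor q x)) (indicator (q x)) _ _)
  (cong₂ _+_ (indicator-xor (p x) (q x) (q⊆p x)) (count-xor-⊆ p q q⊆p xs))
  where
  shuffle : ∀ a b c d → (a + c) + (b + d) ≡ (a + b) + (c + d)
  shuffle = solve-∀
  indicator-xor : ∀ a b → (T b → T a) → indicator (a xor b) + indicator b ≡ indicator a
  indicator-xor true  true  _ = refl
  indicator-xor true  false _ = refl
  indicator-xor false true  b⇒a = ⊥-elim (b⇒a _)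
  indicator-xor false false _ = refl

count-allSubsets-suc : ∀ {N} (p : Subset (suc N) → Bool) →
  count p (allSubsets (suc N)) ≡ count (p ∘ (true ∷_)) (allSubsets N) + count (p ∘ (false ∷_)) (allSubsets N)
count-allSubsets-suc {N} p = trans (count-++ p (map (true ∷_) (allSubsets N)) _)
  (cong₂ _+_ (count-map p (true ∷_) (allSubsets N)) (count-map p (false ∷_) (allSubsets N)))

count-allSubsets-true : ∀ N → count (λ (_ : Subset N) → true) (allSubsets N) ≡ 2 ^ N
count-allSubsets-true zero = refl
count-allSubsets-true (suc N) = trans (count-allSubsets-suc {N} (λ _ → true))
  (trans (cong₂ _+_ (count-allSubsets-true N) (count-allSubsets-true N)) (cong (2 ^ N +_) (sym (+-identityʳ (2 ^ N)))))

-- Splitting a family along the first coordinate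

totalInfCount : ∀ {N} → Family N → ℕ
totalInfCount {N} H = sum (map (infCount H) (allFin N))

slice₁ slice₀ : ∀ {N} → Family (suc N) → Family N
slice₁ H S = H (true ∷ S)
slice₀ H S = H (false ∷ S)

symDiffCount : ∀ {N} → Family N → Family N → ℕ
symDiffCount {N} F G = count (λ S → F S xor G S) (allSubsets N)

infCount-zero : ∀ {N} (H : Family (suc N)) → infCount H fzero ≡ 2 * symDiffCount (slice₁ H) (slice₀ H)
infCount-zero {N} H = begin
  infCount H fzero
    ≡⟨ count-allSubsets-suc (λ A → H A xor H (toggle fzero A)) ⟩
  d + count (λ S → slice₀ H S xor slice₁ H S) (allSubsets N)
    ≡⟨ cong (d +_) (count-cong (λ S → xor-comm (slice₀ H S) (slice₁ H S)) (allSubsets N)) ⟩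
  d + d
    ≡⟨ cong (d +_) (+-identityʳ d) ⟨
  2 * d ∎
  where
  open ≡-Reasoning
  d = symDiffCount (slice₁ H) (slice₀ H)

infCount-suc : ∀ {N} (H : Family (suc N)) i → infCount H (fsuc i) ≡ infCount (slice₁ H) i + infCount (slice₀ H) i
infCount-suc H i = count-allSubsets-suc (λ A → H A xor H (toggle (fsuc i) A))

totalInfCount-split : ∀ {N} (H : Family (suc N)) →
  totalInfCount H ≡ 2 * symDiffCount (slice₁ H) (slice₀ H) + (totalInfCount (slice₁ H) + totalInfCount (slice₀ H))
totalInfCount-split {N} H = begin
  totalInfCount H
    ≡⟨ sum-map-allFin-suc N (infCount H) ⟩
  infCount H fzero + sum (map (infCount H ∘ fsuc) (allFin N))
    ≡⟨ cong₂ _+_ (infCount-zero H) (cong sum (map-cong (infCount-suc H) (allFin N))) ⟩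
  2 * symDiffCount (slice₁ H) (slice₀ H) + sum (map (λ i → infCount (slice₁ H) i + infCount (slice₀ H) i) (allFin N))
    ≡⟨ cong (2 * symDiffCount (slice₁ H) (slice₀ H) +_) (sum-map-+ (infCount (slice₁ H)) (infCount (slice₀ H)) (allFin N)) ⟩
  2 * symDiffCount (slice₁ H) (slice₀ H) + (totalInfCount (slice₁ H) + totalInfCount (slice₀ H)) ∎
  where open ≡-Reasoning

totalInfCount-cong : ∀ {N} {F G : Family N} → F ≗ G → totalInfCount F ≡ totalInfCount G
totalInfCount-cong {N} F≗G = cong sum (map-cong (λ i → count-cong (λ A → cong₂ _xor_ (F≗G A) (F≗G (toggle i A))) (allSubsets N)) (allFin N))

totalInfCount-const : ∀ {N} {F : Family N} b → (∀ S → F S ≡ b) → totalInfCount F ≡ 0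
totalInfCount-const {N} b F≡b = sum-map-zero
  (λ i → count-false (λ A → trans (cong₂ _xor_ (F≡b A) (F≡b (toggle i A))) (xor-same b)) (allSubsets N)) (allFin N)

-- Lexicographic segments

≤ᵇ-cong : ∀ {m n m′ n′} → (m ≤ n → m′ ≤ n′) → (m′ ≤ n′ → m ≤ n) → (m ≤ᵇ n) ≡ (m′ ≤ᵇ n′)
≤ᵇ-cong {m} {n} {m′} {n′} f g = det (≤ᵇ-reflects-≤ m n) (fromEquivalence (g ∘ ≤ᵇ⇒≤ m′ n′) (≤⇒≤ᵇ ∘ f))

≤ᵇ-true : ∀ {m n} → m ≤ n → (m ≤ᵇ n) ≡ true
≤ᵇ-true {m} {n} m≤n = det (≤ᵇ-reflects-≤ m n) (ofʸ m≤n)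

≤ᵇ-false : ∀ {m n} → n ℕ.< m → (m ≤ᵇ n) ≡ false
≤ᵇ-false {m} {n} n<m = det (≤ᵇ-reflects-≤ m n) (ofⁿ (<⇒≱ n<m))

+-cancelˡ-≤ᵇ : ∀ m n o → (m + n ≤ᵇ m + o) ≡ (n ≤ᵇ o)
+-cancelˡ-≤ᵇ m n o = ≤ᵇ-cong (+-cancelˡ-≤ m n o) (+-monoʳ-≤ m)

2^suc : ∀ N → 2 ^ suc N ≡ 2 ^ N + 2 ^ N
2^suc N = cong (2 ^ N +_) (+-identityʳ (2 ^ N))

binVal<2^ : ∀ {N} (S : Subset N) → binVal S ℕ.< 2 ^ N
binVal<2^ {zero}  Vec.[]      = s≤s z≤n
binVal<2^ {suc N} (true ∷ S)  = ≤-trans (+-monoʳ-< (2 ^ N) (binVal<2^ S)) (≤-reflexive (sym (2^suc N)))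
binVal<2^ {suc N} (false ∷ S) = ≤-trans (binVal<2^ S) (≤-trans (m≤m+n (2 ^ N) (2 ^ N)) (≤-reflexive (sym (2^suc N))))

lexSeg-true∷ : ∀ N k (S : Subset N) → lexSeg (suc N) k (true ∷ S) ≡ lexSeg N k S
lexSeg-true∷ N k S = begin
  2 ^ suc N ≤ᵇ (2 ^ N + binVal S) + k   ≡⟨ cong₂ _≤ᵇ_ (2^suc N) (+-assoc (2 ^ N) (binVal S) k) ⟩
  2 ^ N + 2 ^ N ≤ᵇ 2 ^ N + (binVal S + k) ≡⟨ +-cancelˡ-≤ᵇ (2 ^ N) (2 ^ N) (binVal S + k) ⟩
  2 ^ N ≤ᵇ binVal S + k                   ∎
  where open ≡-Reasoning

lexSeg-false∷-high : ∀ N j (S : Subset N) → lexSeg (suc N) (2 ^ N + j) (false ∷ S) ≡ lexSeg N j S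
lexSeg-false∷-high N j S = begin
  2 ^ suc N ≤ᵇ binVal S + (2 ^ N + j)     ≡⟨ cong₂ _≤ᵇ_ (2^suc N) (x∙yz≈y∙xz (binVal S) (2 ^ N) j) ⟩
  2 ^ N + 2 ^ N ≤ᵇ 2 ^ N + (binVal S + j) ≡⟨ +-cancelˡ-≤ᵇ (2 ^ N) (2 ^ N) (binVal S + j) ⟩
  2 ^ N ≤ᵇ binVal S + j                   ∎
  where open ≡-Reasoning

lexSeg-false∷-low : ∀ N k → k ≤ 2 ^ N → (S : Subset N) → lexSeg (suc N) k (false ∷ S) ≡ false
lexSeg-false∷-low N k k≤2^N S = ≤ᵇ-false (≤-trans (+-mono-<-≤ (binVal<2^ S) k≤2^N) (≤-reflexive (sym (2^suc N))))

lexSeg-full : ∀ N k → 2 ^ N ≤ k → (S : Subset N) → lexSeg N k S ≡ true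
lexSeg-full N k 2^N≤k S = ≤ᵇ-true (≤-trans 2^N≤k (m≤n+m k (binVal S)))

lexSeg-empty : ∀ N (S : Subset N) → lexSeg N 0 S ≡ false
lexSeg-empty N S = ≤ᵇ-false (≤-trans (≤-reflexive (cong suc (+-identityʳ (binVal S)))) (binVal<2^ S))

lexSeg-mono : ∀ N {a b} → a ≤ b → (S : Subset N) → T (lexSeg N a S) → T (lexSeg N b S)
lexSeg-mono N a≤b S S∈a = ≤⇒≤ᵇ (≤-trans (≤ᵇ⇒≤ (2 ^ N) _ S∈a) (+-monoʳ-≤ (binVal S) a≤b))

count-lexSeg : ∀ N k → k ≤ 2 ^ N → count (lexSeg N k) (allSubsets N) ≡ k
count-lexSeg zero zero _ = refl
count-lexSeg zero (suc zero) _ = refl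
count-lexSeg zero (suc (suc k)) (s≤s ())
count-lexSeg (suc N) k k≤2^N+1 with k ≤? 2 ^ N
... | yes k≤2^N = begin
  count (lexSeg (suc N) k) (allSubsets (suc N))
    ≡⟨ count-allSubsets-suc (lexSeg (suc N) k) ⟩
  count (λ S → lexSeg (suc N) k (true ∷ S)) (allSubsets N) + count (λ S → lexSeg (suc N) k (false ∷ S)) (allSubsets N)
    ≡⟨ cong₂ _+_ (count-cong (lexSeg-true∷ N k) (allSubsets N)) (count-false (lexSeg-false∷-low N k k≤2^N) (allSubsets N)) ⟩
  count (lexSeg N k) (allSubsets N) + 0
    ≡⟨ trans (+-identityʳ _) (count-lexSeg N k k≤2^N) ⟩
  k ∎
  where open ≡-Reasoning
... | no k≰2^N with m≤n⇒∃[o]m+o≡n (≰⇒≥ k≰2^N)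
...   | j , refl = begin
  count (lexSeg (suc N) (2 ^ N + j)) (allSubsets (suc N))
    ≡⟨ count-allSubsets-suc (lexSeg (suc N) (2 ^ N + j)) ⟩
  count (λ S → lexSeg (suc N) (2 ^ N + j) (true ∷ S)) (allSubsets N) + count (λ S → lexSeg (suc N) (2 ^ N + j) (false ∷ S)) (allSubsets N)
    ≡⟨ cong₂ _+_ (count-cong (λ S → trans (lexSeg-true∷ N _ S) (lexSeg-full N _ (m≤m+n _ j) S)) (allSubsets N))
                 (count-cong (lexSeg-false∷-high N j) (allSubsets N)) ⟩
  count (λ _ → true) (allSubsets N) + count (lexSeg N j) (allSubsets N)
    ≡⟨ cong₂ _+_ (count-allSubsets-true N) (count-lexSeg N j j≤2^N) ⟩
  2 ^ N + j ∎
  where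
  open ≡-Reasoning
  j≤2^N : j ≤ 2 ^ N
  j≤2^N = +-cancelˡ-≤ (2 ^ N) j (2 ^ N) (≤-trans k≤2^N+1 (≤-reflexive (2^suc N)))

symDiffCount-lexSeg : ∀ N {a b} → a ≤ b → b ≤ 2 ^ N → symDiffCount (lexSeg N b) (lexSeg N a) + a ≡ b
symDiffCount-lexSeg N {a} {b} a≤b b≤2^N = begin
  symDiffCount (lexSeg N b) (lexSeg N a) + a
    ≡⟨ cong (symDiffCount (lexSeg N b) (lexSeg N a) +_) (sym (count-lexSeg N a (≤-trans a≤b b≤2^N))) ⟩
  symDiffCount (lexSeg N b) (lexSeg N a) + count (lexSeg N a) (allSubsets N)
    ≡⟨ count-xor-⊆ (lexSeg N b) (lexSeg N a) (lexSeg-mono N a≤b) (allSubsets N) ⟩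
  count (lexSeg N b) (allSubsets N)
    ≡⟨ count-lexSeg N b b≤2^N ⟩
  b ∎
  where open ≡-Reasoning

lexInfCount : ℕ → ℕ → ℕ
lexInfCount N k = totalInfCount (lexSeg N k)

lexInfCount-low : ∀ N k → k ≤ 2 ^ N → lexInfCount (suc N) k ≡ 2 * k + lexInfCount N k
lexInfCount-low N k k≤2^N = begin
  lexInfCount (suc N) k
    ≡⟨ totalInfCount-split (lexSeg (suc N) k) ⟩
  2 * symDiffCount (slice₁ L) (slice₀ L) + (totalInfCount (slice₁ L) + totalInfCount (slice₀ L))
    ≡⟨ cong₂ (λ d e → 2 * d + e) symDiff≡k
             (cong₂ _+_ (totalInfCount-cong (lexSeg-true∷ N k)) (totalInfCount-const false (lexSeg-false∷-low N k k≤2^N))) ⟩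
  2 * k + (lexInfCount N k + 0)
    ≡⟨ cong (2 * k +_) (+-identityʳ _) ⟩
  2 * k + lexInfCount N k ∎
  where
  open ≡-Reasoning
  L = lexSeg (suc N) k
  symDiff≡k : symDiffCount (slice₁ L) (slice₀ L) ≡ k
  symDiff≡k = begin
    symDiffCount (slice₁ L) (slice₀ L)
      ≡⟨ count-cong (λ S → cong₂ _xor_ (lexSeg-true∷ N k S) (trans (lexSeg-false∷-low N k k≤2^N S) (sym (lexSeg-empty N S)))) (allSubsets N) ⟩
    symDiffCount (lexSeg N k) (lexSeg N 0)
      ≡⟨ sym (+-identityʳ _) ⟩
    symDiffCount (lexSeg N k) (lexSeg N 0) + 0
      ≡⟨ symDiffCount-lexSeg N z≤n k≤2^N ⟩
    k ∎

lexInfCount-high : ∀ N j j′ → j + j′ ≡ 2 ^ N → lexInfCount (suc N) (2 ^ N + j) ≡ 2 * j′ + lexInfCount N j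
lexInfCount-high N j j′ j+j′≡2^N = begin
  lexInfCount (suc N) (2 ^ N + j)
    ≡⟨ totalInfCount-split (lexSeg (suc N) (2 ^ N + j)) ⟩
  2 * symDiffCount (slice₁ L) (slice₀ L) + (totalInfCount (slice₁ L) + totalInfCount (slice₀ L))
    ≡⟨ cong₂ (λ d e → 2 * d + e) symDiff≡j′
             (cong₂ _+_ (totalInfCount-const true slice₁-full) (totalInfCount-cong (lexSeg-false∷-high N j))) ⟩
  2 * j′ + lexInfCount N j ∎
  where
  open ≡-Reasoning
  L = lexSeg (suc N) (2 ^ N + j)
  j≤2^N : j ≤ 2 ^ N
  j≤2^N = ≤-trans (m≤m+n j j′) (≤-reflexive j+j′≡2^N)
  slice₁-full : ∀ S → slice₁ L S ≡ true
  slice₁-full S = trans (lexSeg-true∷ N _ S) (lexSeg-full N _ (m≤m+n _ j) S)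
  symDiff≡j′ : symDiffCount (slice₁ L) (slice₀ L) ≡ j′
  symDiff≡j′ = +-cancelʳ-≡ j _ j′ (begin
    symDiffCount (slice₁ L) (slice₀ L) + j
      ≡⟨ cong (_+ j) (count-cong (λ S → cong₂ _xor_ (trans (slice₁-full S) (sym (lexSeg-full N _ ≤-refl S))) (lexSeg-false∷-high N j S)) (allSubsets N)) ⟩
    symDiffCount (lexSeg N (2 ^ N)) (lexSeg N j) + j
      ≡⟨ symDiffCount-lexSeg N j≤2^N ≤-refl ⟩
    2 ^ N
      ≡⟨ trans (sym j+j′≡2^N) (+-comm j j′) ⟩
    j′ + j ∎)

lexInfCount-complement-step : ∀ N → (∀ j j′ → j + j′ ≡ 2 ^ N → lexInfCount N j ≡ lexInfCount N j′) →
  ∀ k k′ → k + k′ ≡ 2 ^ suc N → k ≤ 2 ^ N → lexInfCount (suc N) k ≡ lexInfCount (suc N) k′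
lexInfCount-complement-step N complement k k′ k+k′≡2^N+1 k≤2^N with m≤n⇒∃[o]m+o≡n k≤2^N
... | j , k+j≡2^N = begin
  lexInfCount (suc N) k            ≡⟨ lexInfCount-low N k k≤2^N ⟩
  2 * k + lexInfCount N k          ≡⟨ cong (2 * k +_) (complement k j k+j≡2^N) ⟩
  2 * k + lexInfCount N j          ≡⟨ sym (lexInfCount-high N j k (trans (+-comm j k) k+j≡2^N)) ⟩
  lexInfCount (suc N) (2 ^ N + j)  ≡⟨ cong (lexInfCount (suc N)) (sym k′≡2^N+j) ⟩
  lexInfCount (suc N) k′           ∎
  where
  open ≡-Reasoning
  k′≡2^N+j : k′ ≡ 2 ^ N + j
  k′≡2^N+j = +-cancelˡ-≡ k k′ (2 ^ N + j) (begin
    k + k′             ≡⟨ trans k+k′≡2^N+1 (2^suc N) ⟩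
    2 ^ N + 2 ^ N      ≡⟨ cong (_+ 2 ^ N) (sym k+j≡2^N) ⟩
    (k + j) + 2 ^ N    ≡⟨ trans (+-assoc k j (2 ^ N)) (cong (k +_) (+-comm j (2 ^ N))) ⟩
    k + (2 ^ N + j)    ∎)

lexInfCount-complement : ∀ N k k′ → k + k′ ≡ 2 ^ N → lexInfCount N k ≡ lexInfCount N k′
lexInfCount-complement zero k k′ _ = refl
lexInfCount-complement (suc N) k k′ k+k′≡2^N+1 with k ≤? 2 ^ N
... | yes k≤2^N = lexInfCount-complement-step N (lexInfCount-complement N) k k′ k+k′≡2^N+1 k≤2^N
... | no k≰2^N = sym (lexInfCount-complement-step N (lexInfCount-complement N) k′ k (trans (+-comm k′ k) k+k′≡2^N+1) k′≤2^N)
  where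
  k′≤2^N : k′ ≤ 2 ^ N
  k′≤2^N = +-cancelˡ-≤ (2 ^ N) k′ (2 ^ N) (begin
    2 ^ N + k′   ≤⟨ +-monoˡ-≤ k′ (≰⇒≥ k≰2^N) ⟩
    k + k′       ≡⟨ trans k+k′≡2^N+1 (2^suc N) ⟩
    2 ^ N + 2 ^ N ∎)
    where open ≤-Reasoning

lexInfCount-low-complement : ∀ N k k′ → k + k′ ≡ 2 ^ N → lexInfCount (suc N) k ≡ 2 * k + lexInfCount N k′
lexInfCount-low-complement N k k′ k+k′≡2^N =
  trans (lexInfCount-low N k (≤-trans (m≤m+n k k′) (≤-reflexive k+k′≡2^N)))
        (cong (2 * k +_) (lexInfCount-complement N k k′ k+k′≡2^N))

lexInfCount-high-complement : ∀ N j j′ → j + j′ ≡ 2 ^ N → lexInfCount (suc N) (2 ^ N + j) ≡ 2 * j′ + lexInfCount N j′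
lexInfCount-high-complement N j j′ j+j′≡2^N =
  trans (lexInfCount-high N j j′ j+j′≡2^N) (cong (2 * j′ +_) (lexInfCount-complement N j j′ j+j′≡2^N))

-- Subadditivity with a bonus

drop-2^-≤ : ∀ N y z → y + (2 ^ N + z) ≤ 2 ^ suc N → y + z ≤ 2 ^ N
drop-2^-≤ N y z le = +-cancelˡ-≤ (2 ^ N) (y + z) (2 ^ N)
  (≤-trans (≤-reflexive (sym (x∙yz≈y∙xz y (2 ^ N) z))) (≤-trans le (≤-reflexive (2^suc N))))

SubadditiveWithBonus : ℕ → Set
SubadditiveWithBonus N = ∀ y z → y ≤ z → y + z ≤ 2 ^ N → 4 * y + lexInfCount N (y + z) ≤ lexInfCount N y + lexInfCount N z

subadditiveWithBonus⇒subadditive : ∀ N → SubadditiveWithBonus N → ∀ y z → y + z ≤ 2 ^ N → lexInfCount N (y + z) ≤ lexInfCount N y + lexInfCount N z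
subadditiveWithBonus⇒subadditive N bonus y z y+z≤2^N with ≤-total y z
... | inj₁ y≤z = ≤-trans (m≤n+m _ (4 * y)) (bonus y z y≤z y+z≤2^N)
... | inj₂ z≤y = subst₂ _≤_ (cong (lexInfCount N) (+-comm z y)) (+-comm (lexInfCount N z) (lexInfCount N y))
                   (≤-trans (m≤n+m _ (4 * z)) (bonus z y z≤y (≤-trans (≤-reflexive (+-comm z y)) y+z≤2^N)))

bonus-step-low : ∀ N y z → y + z ≤ 2 ^ N →
  4 * y + lexInfCount N (y + z) ≤ lexInfCount N y + lexInfCount N z →
  4 * y + lexInfCount (suc N) (y + z) ≤ lexInfCount (suc N) y + lexInfCount (suc N) z
bonus-step-low N y z y+z≤2^N bonus = begin
  4 * y + lexInfCount (suc N) (y + z)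
    ≡⟨ cong (4 * y +_) (lexInfCount-low N (y + z) y+z≤2^N) ⟩
  4 * y + (2 * (y + z) + lexInfCount N (y + z))
    ≡⟨ regroupˡ (4 * y) (2 * (y + z)) _ ⟩
  2 * (y + z) + (4 * y + lexInfCount N (y + z))
    ≤⟨ +-monoʳ-≤ (2 * (y + z)) bonus ⟩
  2 * (y + z) + (lexInfCount N y + lexInfCount N z)
    ≡⟨ regroupʳ y z _ _ ⟩
  (2 * y + lexInfCount N y) + (2 * z + lexInfCount N z)
    ≡⟨ sym (cong₂ _+_ (lexInfCount-low N y y≤2^N) (lexInfCount-low N z z≤2^N)) ⟩
  lexInfCount (suc N) y + lexInfCount (suc N) z ∎
  where
  open ≤-Reasoning
  y≤2^N = ≤-trans (m≤m+n y z) y+z≤2^N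
  z≤2^N = ≤-trans (m≤n+m z y) y+z≤2^N
  regroupˡ : ∀ a b c → a + (b + c) ≡ b + (a + c)
  regroupˡ = solve-∀
  regroupʳ : ∀ y z a b → 2 * (y + z) + (a + b) ≡ (2 * y + a) + (2 * z + b)
  regroupʳ = solve-∀

bonus-step-high : ∀ N y z′ c → y + z′ ≤ 2 ^ N →
  c + lexInfCount N (y + z′) ≤ lexInfCount N y + lexInfCount N z′ →
  (c + 4 * y) + lexInfCount (suc N) (y + (2 ^ N + z′)) ≤ lexInfCount (suc N) y + lexInfCount (suc N) (2 ^ N + z′)
bonus-step-high N y z′ c y+z′≤2^N bonus with m≤n⇒∃[o]m+o≡n y+z′≤2^N
... | t , y+z′+t≡2^N = begin
  (c + 4 * y) + lexInfCount (suc N) (y + (2 ^ N + z′))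
    ≡⟨ cong (λ k → (c + 4 * y) + lexInfCount (suc N) k) (x∙yz≈y∙xz y (2 ^ N) z′) ⟩
  (c + 4 * y) + lexInfCount (suc N) (2 ^ N + (y + z′))
    ≡⟨ cong ((c + 4 * y) +_) (lexInfCount-high N (y + z′) t y+z′+t≡2^N) ⟩
  (c + 4 * y) + (2 * t + lexInfCount N (y + z′))
    ≡⟨ regroupˡ c (4 * y) (2 * t) _ ⟩
  (2 * t + 4 * y) + (c + lexInfCount N (y + z′))
    ≤⟨ +-monoʳ-≤ (2 * t + 4 * y) bonus ⟩
  (2 * t + 4 * y) + (lexInfCount N y + lexInfCount N z′)
    ≡⟨ regroupʳ t y _ _ ⟩
  (2 * y + lexInfCount N y) + (2 * (t + y) + lexInfCount N z′)
    ≡⟨ sym (cong₂ _+_ (lexInfCount-low N y y≤2^N) (lexInfCount-high N z′ (t + y) z′+t+y≡2^N)) ⟩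
  lexInfCount (suc N) y + lexInfCount (suc N) (2 ^ N + z′) ∎
  where
  open ≤-Reasoning
  y≤2^N = ≤-trans (m≤m+n y z′) y+z′≤2^N
  z′+t+y≡2^N : z′ + (t + y) ≡ 2 ^ N
  z′+t+y≡2^N = trans (rotate y z′ t) y+z′+t≡2^N
    where
    rotate : ∀ y z t → z + (t + y) ≡ (y + z) + t
    rotate = solve-∀
  regroupˡ : ∀ c a b e → (c + a) + (b + e) ≡ (b + a) + (c + e)
  regroupˡ = solve-∀
  regroupʳ : ∀ t y a b → (2 * t + 4 * y) + (a + b) ≡ (2 * y + a) + (2 * (t + y) + b)
  regroupʳ = solve-∀

-- Complementing in P([N]) turns the sizes y, z into u = 2^N - z ≤ v = 2^N - y,
-- and the crossing case into the bonus inequality for (u, v).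
bonus-step-crossing : ∀ N → SubadditiveWithBonus N → ∀ y z → y ≤ z → z ≤ 2 ^ N → 2 ^ N ≤ y + z →
  4 * y + lexInfCount (suc N) (y + z) ≤ lexInfCount (suc N) y + lexInfCount (suc N) z
bonus-step-crossing N bonus y z y≤z z≤2^N 2^N≤y+z
  with m≤n⇒∃[o]m+o≡n (≤-trans y≤z z≤2^N) | m≤n⇒∃[o]m+o≡n z≤2^N | m≤n⇒∃[o]m+o≡n 2^N≤y+z
... | v , y+v≡2^N | u , z+u≡2^N | w , 2^N+w≡y+z = begin
  4 * y + lexInfCount (suc N) (y + z)
    ≡⟨ cong (λ k → 4 * y + lexInfCount (suc N) k) 2^N+w≡y+z ⟨
  4 * y + lexInfCount (suc N) (2 ^ N + w)
    ≡⟨ cong (4 * y +_) (lexInfCount-high-complement N w (u + v) w+u+v≡2^N) ⟩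
  4 * y + (2 * (u + v) + lexInfCount N (u + v))
    ≡⟨ trans (regroup₁ y u v _) (cong (λ k → (2 * u + lexInfCount N (u + v)) + (2 * y + 2 * k)) y+v≡z+u) ⟩
  (2 * u + lexInfCount N (u + v)) + (2 * y + 2 * (z + u))
    ≡⟨ regroup₂ y z u _ ⟩
  (4 * u + lexInfCount N (u + v)) + (2 * y + 2 * z)
    ≤⟨ +-monoˡ-≤ (2 * y + 2 * z) (bonus u v u≤v u+v≤2^N) ⟩
  (lexInfCount N u + lexInfCount N v) + (2 * y + 2 * z)
    ≡⟨ regroup₃ y z _ _ ⟩
  (2 * y + lexInfCount N v) + (2 * z + lexInfCount N u)
    ≡⟨ cong₂ _+_ (lexInfCount-low-complement N y v y+v≡2^N) (lexInfCount-low-complement N z u z+u≡2^N) ⟨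
  lexInfCount (suc N) y + lexInfCount (suc N) z ∎
  where
  open ≤-Reasoning
  y+v≡z+u : y + v ≡ z + u
  y+v≡z+u = trans y+v≡2^N (sym z+u≡2^N)
  w+u+v≡2^N : w + (u + v) ≡ 2 ^ N
  w+u+v≡2^N = +-cancelˡ-≡ (2 ^ N) _ _ (begin-equality
    2 ^ N + (w + (u + v))  ≡⟨ +-assoc (2 ^ N) w (u + v) ⟨
    (2 ^ N + w) + (u + v)  ≡⟨ cong (_+ (u + v)) 2^N+w≡y+z ⟩
    (y + z) + (u + v)      ≡⟨ interchange y z u v ⟩
    (y + v) + (z + u)      ≡⟨ cong₂ _+_ y+v≡2^N z+u≡2^N ⟩
    2 ^ N + 2 ^ N          ∎)
    where
    interchange : ∀ y z u v → (y + z) + (u + v) ≡ (y + v) + (z + u)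
    interchange = solve-∀
  u≤v : u ≤ v
  u≤v = +-cancelˡ-≤ z u v (≤-trans (≤-reflexive (sym y+v≡z+u)) (+-monoˡ-≤ v y≤z))
  u+v≤2^N : u + v ≤ 2 ^ N
  u+v≤2^N = ≤-trans (m≤n+m (u + v) w) (≤-reflexive w+u+v≡2^N)
  regroup₁ : ∀ y u v e → 4 * y + (2 * (u + v) + e) ≡ (2 * u + e) + (2 * y + 2 * (y + v))
  regroup₁ = solve-∀
  regroup₂ : ∀ y z u e → (2 * u + e) + (2 * y + 2 * (z + u)) ≡ (4 * u + e) + (2 * y + 2 * z)
  regroup₂ = solve-∀
  regroup₃ : ∀ y z a b → (a + b) + (2 * y + 2 * z) ≡ (2 * y + b) + (2 * z + a)
  regroup₃ = solve-∀

lexInfCount-subadditiveWithBonus : ∀ N → SubadditiveWithBonus N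
lexInfCount-subadditiveWithBonus zero zero z _ _ = z≤n
lexInfCount-subadditiveWithBonus zero (suc y) z y<z y+z≤1 with ≤-trans (+-mono-≤ (s≤s (z≤n {y})) (≤-trans (s≤s z≤n) y<z)) y+z≤1
... | s≤s ()
lexInfCount-subadditiveWithBonus (suc N) y z y≤z y+z≤2^N+1 with y + z ≤? 2 ^ N | z ≤? 2 ^ N
... | yes y+z≤2^N | _ = bonus-step-low N y z y+z≤2^N (lexInfCount-subadditiveWithBonus N y z y≤z y+z≤2^N)
... | no y+z≰2^N | yes z≤2^N = bonus-step-crossing N (lexInfCount-subadditiveWithBonus N) y z y≤z z≤2^N (<⇒≤ (≰⇒> y+z≰2^N))
... | no _ | no z≰2^N with m≤n⇒∃[o]m+o≡n (<⇒≤ (≰⇒> z≰2^N))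
...   | z′ , refl = bonus-step-high N y z′ 0 y+z′≤2^N (subadditiveWithBonus⇒subadditive N (lexInfCount-subadditiveWithBonus N) y z′ y+z′≤2^N)
  where
  y+z′≤2^N : y + z′ ≤ 2 ^ N
  y+z′≤2^N = drop-2^-≤ N y z′ y+z≤2^N+1

lexInfCount-double-bonus : ∀ m a b → 2 * a + 2 ^ m ≤ 2 * b → a + b ≤ 2 ^ m →
  (4 * a + 4 * a) + lexInfCount m (a + b) ≤ lexInfCount m a + lexInfCount m b
lexInfCount-double-bonus zero zero b _ _ = z≤n
lexInfCount-double-bonus zero (suc a) b 2a+1≤2b a+b≤1 = ⊥-elim (n≮0 (≤-trans 2a+1≤2b (*-monoʳ-≤ 2 b≤0)))
  where
  b≤0 : b ≤ 0
  b≤0 = +-cancelˡ-≤ 1 b 0 (≤-trans (+-monoˡ-≤ b (s≤s z≤n)) a+b≤1)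
lexInfCount-double-bonus (suc n) a b 2a+2^n+1≤2b a+b≤2^n+1
  with *-cancelˡ-≤ {a + 2 ^ n} {b} 2 (≤-trans (≤-reflexive (*-distribˡ-+ 2 a (2 ^ n))) 2a+2^n+1≤2b)
... | a+2^n≤b with m≤n⇒∃[o]m+o≡n (≤-trans (m≤n+m (2 ^ n) a) a+2^n≤b)
...   | b′ , refl = bonus-step-high n a b′ (4 * a) a+b′≤2^n (lexInfCount-subadditiveWithBonus n a b′ a≤b′ a+b′≤2^n)
  where
  a≤b′ : a ≤ b′
  a≤b′ = +-cancelʳ-≤ (2 ^ n) a b′ (≤-trans a+2^n≤b (≤-reflexive (+-comm (2 ^ n) b′)))
  a+b′≤2^n : a + b′ ≤ 2 ^ n
  a+b′≤2^n = drop-2^-≤ n a b′ a+b≤2^n+1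

lexTwo-bonus : ∀ m a b → 2 * a + 2 ^ m ≤ 2 * b → a + b ≤ 2 ^ m →
  lexInfCount (suc m) (a + b) + 4 * a ≤ totalInfCount (lexTwo m a b)
lexTwo-bonus m a b 2a+2^m≤2b a+b≤2^m with m≤n⇒∃[o]m+o≡n (*-cancelˡ-≤ {a} {b} 2 (≤-trans (m≤m+n (2 * a) (2 ^ m)) 2a+2^m≤2b))
... | c , refl = begin
  lexInfCount (suc m) (a + (a + c)) + 4 * a
    ≡⟨ cong (_+ 4 * a) (lexInfCount-low m _ a+b≤2^m) ⟩
  (2 * (a + (a + c)) + lexInfCount m (a + (a + c))) + 4 * a
    ≡⟨ regroup a c _ ⟩
  2 * c + ((4 * a + 4 * a) + lexInfCount m (a + (a + c)))
    ≤⟨ +-monoʳ-≤ (2 * c) (lexInfCount-double-bonus m a (a + c) 2a+2^m≤2b a+b≤2^m) ⟩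
  2 * c + (lexInfCount m a + lexInfCount m (a + c))
    ≡⟨ cong₂ (λ d e → 2 * d + e) (sym symDiff≡c) (+-comm (lexInfCount m a) _) ⟩
  2 * symDiffCount (lexSeg m (a + c)) (lexSeg m a) + (lexInfCount m (a + c) + lexInfCount m a)
    ≡⟨ sym (totalInfCount-split (lexTwo m a (a + c))) ⟩
  totalInfCount (lexTwo m a (a + c)) ∎
  where
  open ≤-Reasoning
  symDiff≡c : symDiffCount (lexSeg m (a + c)) (lexSeg m a) ≡ c
  symDiff≡c = +-cancelʳ-≡ a _ c (trans (symDiffCount-lexSeg m (m≤m+n a c) (≤-trans (m≤n+m (a + c) a) a+b≤2^m)) (+-comm a c))
  regroup : ∀ a c e → (2 * (a + (a + c)) + e) + 4 * a ≡ 2 * c + ((4 * a + 4 * a) + e)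
  regroup = solve-∀

-- Dyadic rationals

dyadicᵘ : ℕ → ℕ → ℚᵘ
dyadicᵘ x N = mkℚᵘ (ℤ.+ x) (pred (2 ^ N))

↧-dyadicᵘ : ∀ x N → ↧ dyadicᵘ x N ≡ ℤ.+ 2 ^ N
↧-dyadicᵘ x N = cong ℤ.+_ (suc-pred (2 ^ N) {{m^n≢0 2 N}})

↥*↧-dyadicᵘ : ∀ x N y M → ↥ dyadicᵘ x N ℤ.* ↧ dyadicᵘ y M ≡ ℤ.+ (x * 2 ^ M)
↥*↧-dyadicᵘ x N y M = trans (cong (ℤ.+ x ℤ.*_) (↧-dyadicᵘ y M)) (sym (ℤₚ.pos-* x (2 ^ M)))

toℚᵘ-dyadic : ∀ x N → toℚᵘ (dyadic x N) ℚᵘ.≃ dyadicᵘ x N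
toℚᵘ-dyadic x N = ℚᵘₚ.≃-trans (ℚₚ.toℚᵘ-cong dyadic≡) (ℚₚ.toℚᵘ-fromℚᵘ (dyadicᵘ x N))
  where
  instance _ = m^n≢0 2 N
  dyadic≡ : dyadic x N ≡ fromℚᵘ (dyadicᵘ x N)
  dyadic≡ = ℚₚ./-cong {p₁ = ℤ.+ x} {p₂ = ℤ.+ x} refl (sym (suc-pred (2 ^ N)))

dyadicᵘ-≃ : ∀ x N y M → x * 2 ^ M ≡ y * 2 ^ N → dyadicᵘ x N ℚᵘ.≃ dyadicᵘ y M
dyadicᵘ-≃ x N y M eq = *≡* (trans (↥*↧-dyadicᵘ x N y M) (trans (cong ℤ.+_ eq) (sym (↥*↧-dyadicᵘ y M x N))))

≃-dyadicᵘ : ∀ p x N k → ↥ p ≡ ℤ.+ (x * k) → ↧ p ≡ ℤ.+ (2 ^ N * k) → p ℚᵘ.≃ dyadicᵘ x N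
≃-dyadicᵘ p x N k ↥p ↧p = *≡* (begin
  ↥ p ℤ.* ↧ dyadicᵘ x N     ≡⟨ cong₂ ℤ._*_ ↥p (↧-dyadicᵘ x N) ⟩
  ℤ.+ (x * k) ℤ.* ℤ.+ 2 ^ N     ≡⟨ sym (ℤₚ.pos-* (x * k) (2 ^ N)) ⟩
  ℤ.+ (x * k * 2 ^ N)         ≡⟨ cong ℤ.+_ (regroup x k (2 ^ N)) ⟩
  ℤ.+ (x * (2 ^ N * k))       ≡⟨ ℤₚ.pos-* x (2 ^ N * k) ⟩
  ℤ.+ x ℤ.* ℤ.+ (2 ^ N * k)     ≡⟨ cong (ℤ.+ x ℤ.*_) (sym ↧p) ⟩
  ↥ dyadicᵘ x N ℤ.* ↧ p     ∎)
  where
  open ≡-Reasoning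
  regroup : ∀ x k P → x * k * P ≡ x * (P * k)
  regroup = solve-∀

≡-dyadic : ∀ {p} z K → toℚᵘ p ℚᵘ.≃ dyadicᵘ z K → p ≡ dyadic z K
≡-dyadic z K p≃ = ℚₚ.toℚᵘ-injective (ℚᵘₚ.≃-trans p≃ (ℚᵘₚ.≃-sym (toℚᵘ-dyadic z K)))

dyadic-cong : ∀ x N y M → x * 2 ^ M ≡ y * 2 ^ N → dyadic x N ≡ dyadic y M
dyadic-cong x N y M eq = ≡-dyadic y M (ℚᵘₚ.≃-trans (toℚᵘ-dyadic x N) (dyadicᵘ-≃ x N y M eq))

dyadic-+ : ∀ x y N → dyadic x N +ℚ dyadic y N ≡ dyadic (x + y) N
dyadic-+ x y N = ≡-dyadic (x + y) N (ℚᵘₚ.≃-trans (ℚₚ.toℚᵘ-homo-+ (dyadic x N) (dyadic y N))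
  (ℚᵘₚ.≃-trans (ℚᵘₚ.+-cong (toℚᵘ-dyadic x N) (toℚᵘ-dyadic y N))
               (≃-dyadicᵘ _ (x + y) N (2 ^ N) ↥-sum ↧-sum)))
  where
  ↥-sum : ↥ (dyadicᵘ x N ℚᵘ.+ dyadicᵘ y N) ≡ ℤ.+ ((x + y) * 2 ^ N)
  ↥-sum = trans (cong₂ ℤ._+_ (↥*↧-dyadicᵘ x N y N) (↥*↧-dyadicᵘ y N x N))
                (trans (sym (ℤₚ.pos-+ (x * 2 ^ N) (y * 2 ^ N))) (cong ℤ.+_ (sym (*-distribʳ-+ (2 ^ N) x y))))
  ↧-sum : ↧ (dyadicᵘ x N ℚᵘ.+ dyadicᵘ y N) ≡ ℤ.+ (2 ^ N * 2 ^ N)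
  ↧-sum = cong ℤ.+_ (cong₂ _*_ (suc-pred (2 ^ N) {{m^n≢0 2 N}}) (suc-pred (2 ^ N) {{m^n≢0 2 N}}))

dyadic-* : ∀ x N y M → dyadic x N *ℚ dyadic y M ≡ dyadic (x * y) (N + M)
dyadic-* x N y M = ≡-dyadic (x * y) (N + M) (ℚᵘₚ.≃-trans (ℚₚ.toℚᵘ-homo-* (dyadic x N) (dyadic y M))
  (ℚᵘₚ.≃-trans (ℚᵘₚ.*-cong (toℚᵘ-dyadic x N) (toℚᵘ-dyadic y M))
               (≃-dyadicᵘ _ (x * y) (N + M) 1 ↥-prod ↧-prod)))
  where
  ↥-prod : ↥ (dyadicᵘ x N ℚᵘ.* dyadicᵘ y M) ≡ ℤ.+ (x * y * 1)
  ↥-prod = trans (sym (ℤₚ.pos-* x y)) (cong ℤ.+_ (sym (*-identityʳ (x * y))))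
  ↧-prod : ↧ (dyadicᵘ x N ℚᵘ.* dyadicᵘ y M) ≡ ℤ.+ (2 ^ (N + M) * 1)
  ↧-prod = cong ℤ.+_ (trans (cong₂ _*_ (suc-pred (2 ^ N) {{m^n≢0 2 N}}) (suc-pred (2 ^ M) {{m^n≢0 2 M}}))
                   (trans (sym (^-distribˡ-+-* 2 N M)) (sym (*-identityʳ _))))

dyadic-mono-≤ : ∀ {x y} N → x ≤ y → dyadic x N ≤ℚ dyadic y N
dyadic-mono-≤ {x} {y} N x≤y = ℚₚ.toℚᵘ-cancel-≤
  (ℚᵘₚ.≤-respˡ-≃ (ℚᵘₚ.≃-sym (toℚᵘ-dyadic x N)) (ℚᵘₚ.≤-respʳ-≃ (ℚᵘₚ.≃-sym (toℚᵘ-dyadic y N))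
    (*≤* (subst₂ ℤ._≤_ (sym (↥*↧-dyadicᵘ x N y N)) (sym (↥*↧-dyadicᵘ y N x N)) (+≤+ (*-monoˡ-≤ (2 ^ N) x≤y))))))

dyadic-cancel-≤ : ∀ {x y} N → dyadic x N ≤ℚ dyadic y N → x ≤ y
dyadic-cancel-≤ {x} {y} N le with ℚᵘₚ.≤-respˡ-≃ (toℚᵘ-dyadic x N) (ℚᵘₚ.≤-respʳ-≃ (toℚᵘ-dyadic y N) (ℚₚ.toℚᵘ-mono-≤ le))
... | *≤* cross = *-cancelʳ-≤ x y (2 ^ N) {{m^n≢0 2 N}}
  (ℤₚ.drop‿+≤+ (subst₂ ℤ._≤_ (↥*↧-dyadicᵘ x N y N) (↥*↧-dyadicᵘ y N x N) cross))


totalInfluence-dyadic : ∀ {N} (H : Family N) → totalInfluence H ≡ dyadic (totalInfCount H) N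
totalInfluence-dyadic {N} H = foldr-dyadic (infCount H) (allFin N)
  where
  foldr-dyadic : ∀ {A : Set} (f : A → ℕ) xs → foldr _+ℚ_ 0ℚ (map (λ x → dyadic (f x) N) xs) ≡ dyadic (sum (map f xs)) N
  foldr-dyadic f [] = dyadic-cong 0 0 0 N refl
  foldr-dyadic f (x ∷ xs) = trans (cong (dyadic (f x) N +ℚ_) (foldr-dyadic f xs)) (dyadic-+ (f x) _ N)

dyadic-double : ∀ x N → dyadic x N ≡ dyadic (2 * x) (suc N)
dyadic-double x N = dyadic-cong x N (2 * x) (suc N) (shift x (2 ^ N))
  where
  shift : ∀ x p → x * (2 * p) ≡ 2 * x * p
  shift = solve-∀

r≤¼⇒a+b≤2^m : ∀ m a b r → dyadic (a + b) (suc m) ≡ dyadic 1 2 +ℚ r → r ≤ℚ dyadic 1 2 → a + b ≤ 2 ^ m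
r≤¼⇒a+b≤2^m m a b r μ≡¼+r r≤¼ = dyadic-cancel-≤ (suc m) (begin
  dyadic (a + b) (suc m)    ≡⟨ μ≡¼+r ⟩
  dyadic 1 2 +ℚ r           ≤⟨ ℚₚ.+-monoʳ-≤ (dyadic 1 2) r≤¼ ⟩
  dyadic 1 2 +ℚ dyadic 1 2  ≡⟨ dyadic-+ 1 1 2 ⟩
  dyadic 2 2                ≡⟨ dyadic-cong 2 2 (2 ^ m) (suc m) (rescale (2 ^ m)) ⟩
  dyadic (2 ^ m) (suc m)    ∎)
  where
  open ℚₚ.≤-Reasoning
  rescale : ∀ p → 2 * (2 * p) ≡ p * 4
  rescale = solve-∀

μ⁻≤r⇒2a+2^m≤2b : ∀ m a b r → dyadic (a + b) (suc m) ≡ dyadic 1 2 +ℚ r → dyadic a m ≤ℚ r → 2 * a + 2 ^ m ≤ 2 * b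
μ⁻≤r⇒2a+2^m≤2b m a b r μ≡¼+r μ⁻≤r = +-cancelˡ-≤ (2 * a) (2 * a + 2 ^ m) (2 * b)
  (subst₂ _≤_ (regroup a (2 ^ m)) (*-distribˡ-+ 2 a b) (dyadic-cancel-≤ (2 + m) (begin
    dyadic (2 * (2 * a) + 2 ^ m) (2 + m)                   ≡⟨ dyadic-+ (2 * (2 * a)) (2 ^ m) (2 + m) ⟨
    dyadic (2 * (2 * a)) (2 + m) +ℚ dyadic (2 ^ m) (2 + m)  ≡⟨ cong₂ _+ℚ_ μ⁻≡ ¼≡ ⟨
    dyadic a m +ℚ dyadic 1 2                               ≤⟨ ℚₚ.+-monoˡ-≤ (dyadic 1 2) μ⁻≤r ⟩
    r +ℚ dyadic 1 2                                        ≡⟨ trans (ℚₚ.+-comm r (dyadic 1 2)) (sym μ≡¼+r) ⟩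
    dyadic (a + b) (suc m)                                 ≡⟨ dyadic-double (a + b) (suc m) ⟩
    dyadic (2 * (a + b)) (2 + m)                           ∎)))
  where
  open ℚₚ.≤-Reasoning
  μ⁻≡ : dyadic a m ≡ dyadic (2 * (2 * a)) (2 + m)
  μ⁻≡ = trans (dyadic-double a m) (dyadic-double (2 * a) (suc m))
  ¼≡ : dyadic 1 2 ≡ dyadic (2 ^ m) (2 + m)
  ¼≡ = dyadic-cong 1 2 (2 ^ m) (2 + m) (rescale (2 ^ m))
    where
    rescale : ∀ p → 1 * (2 * (2 * p)) ≡ p * 4
    rescale = solve-∀
  regroup : ∀ a p → 2 * (2 * a) + p ≡ 2 * a + (2 * a + p)
  regroup = solve-∀

claim5p2 : (m a b : ℕ) → a ≤ 2 ^ m → b ≤ 2 ^ m → (r : ℚ)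
    → dyadic (a + b) (suc m) ≡ dyadic 1 2 +ℚ r
    → 0ℚ < r → r ≤ℚ dyadic 1 2
    → dyadic a m ≤ℚ r
    → totalInfluence (lexSeg (suc m) (a + b)) +ℚ dyadic 2 0 *ℚ dyadic a m ≤ℚ totalInfluence (lexTwo m a b)
claim5p2 m a b _ _ r μ≡¼+r _ r≤¼ μ⁻≤r = begin
  totalInfluence (lexSeg (suc m) (a + b)) +ℚ dyadic 2 0 *ℚ dyadic a m
    ≡⟨ cong₂ _+ℚ_ (totalInfluence-dyadic (lexSeg (suc m) (a + b))) 2μ⁻≡ ⟩
  dyadic (lexInfCount (suc m) (a + b)) (suc m) +ℚ dyadic (4 * a) (suc m)
    ≡⟨ dyadic-+ (lexInfCount (suc m) (a + b)) (4 * a) (suc m) ⟩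
  dyadic (lexInfCount (suc m) (a + b) + 4 * a) (suc m)
    ≤⟨ dyadic-mono-≤ (suc m) (lexTwo-bonus m a b (μ⁻≤r⇒2a+2^m≤2b m a b r μ≡¼+r μ⁻≤r) (r≤¼⇒a+b≤2^m m a b r μ≡¼+r r≤¼)) ⟩
  dyadic (totalInfCount (lexTwo m a b)) (suc m)
    ≡⟨ totalInfluence-dyadic (lexTwo m a b) ⟨
  totalInfluence (lexTwo m a b) ∎
  where
  open ℚₚ.≤-Reasoning
  2μ⁻≡ : dyadic 2 0 *ℚ dyadic a m ≡ dyadic (4 * a) (suc m)
  2μ⁻≡ = trans (dyadic-* 2 0 a m) (dyadic-cong (2 * a) m (4 * a) (suc m) (rescale a (2 ^ m)))
    where
    rescale : ∀ a p → 2 * a * (2 * p) ≡ 4 * a * p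
    rescale = solve-∀
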